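{- Let $G$ be a graph with $n$ vertices, $M=M[IAS(G)]$, and let $q$ be the cardinality of the smallest transverse circuit(s) of $M$. If $q<\frac{n+1}{2}$, then $2q-1\ge\kappa(M)$.
   Context: A graph is a finite looped simple graph; $A(G)$ is its $GF(2)$ adjacency matrix (diagonal 1 iff looped). $M[IAS(G)]$ is the binary matroid represented by $(I\;A(G)\;A(G)+I)$, with elements $\phi_G(v),\chi_G(v),\psi_G(v)$ for $v\in V(G)$; $\tau_G(v)=\{\phi_G(v),\chi_G(v),\psi_G(v)\}$ is the vertex triple. A transversal is a subset of the ground set meeting every vertex triple exactly once; a transverse circuit is a circuit of $M$ contained in some transversal (i.e., a circuit of the restriction of $M$ to a transversal). For a matroid on $W$ with rank $r$, $\lambda(S)=r(S)+r(W-S)-r(M)$; $S$ is a vertical $k$-separation if $\lambda(S)<k$ and $r(S),r(W-S)\ge k$; $\kappa(M)=\min(\{k\mid\text{vertical }k\text{ -separation exists}\}\cup\{r(M)\})$. -}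

module Defs where

open import Data.Nat using (ℕ; zero; suc; _+_; _≤_; _<_)
open import Data.Fin using (Fin; zero; suc)
open import Data.Fin.Properties using (_≟_)
open import Data.Bool using (Bool; true; false; _∧_; _xor_; not)
open import Data.Product using (Σ; ∃; _×_; _,_)
open import Data.Sum using (_⊎_)
open import Relation.Binary.PropositionalEquality using (_≡_; _≢_)
open import Relation.Nullary using (¬_)
open import Relation.Nullary.Decidable using (⌊_⌋)

-- A (finite, looped simple) graph on vertex set Fin n, given by its
-- symmetric GF(2) adjacency matrix; adj v v ≡ true iff v is looped.
record Graph (n : ℕ) : Set where
  field
    adj : Fin n → Fin n → Bool
    sym : ∀ u v → adj u v ≡ adj v u
open Graph public

GF2Vec : ℕ → Set
GF2Vec n = Fin n → Bool

-- Ground set of M[IAS(G)]: pairs (v , t), t : Fin 3, where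
-- t = 0 is φ_G(v), t = 1 is χ_G(v), t = 2 is ψ_G(v).
-- Subsets of the ground set are characteristic functions.
ESet : ℕ → Set
ESet n = Fin n → Fin 3 → Bool

-- The column of the matrix (I  A(G)  A(G)+I) representing element (v , t).
column : ∀ {n} → Graph n → Fin n → Fin 3 → GF2Vec n
column G v zero w = ⌊ w ≟ v ⌋
column G v (suc zero) w = adj G w v
column G v (suc (suc zero)) w = adj G w v xor ⌊ w ≟ v ⌋

xorFin : ∀ m → (Fin m → Bool) → Bool
xorFin zero f = false
xorFin (suc m) f = f zero xor xorFin m (λ i → f (suc i))

sumFin : ∀ m → (Fin m → ℕ) → ℕ
sumFin zero f = 0
sumFin (suc m) f = f zero + sumFin m (λ i → f (suc i))

b2n : Bool → ℕ
b2n true = 1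
b2n false = 0

colSum : ∀ {n} → Graph n → ESet n → GF2Vec n
colSum {n} G S w = xorFin n (λ v → xorFin 3 (λ t → S v t ∧ column G v t w))

IsZeroVec : ∀ {n} → GF2Vec n → Set
IsZeroVec x = ∀ w → x w ≡ false

card : ∀ {n} → ESet n → ℕ
card {n} S = sumFin n (λ v → sumFin 3 (λ t → b2n (S v t)))

_⊆_ : ∀ {n} → ESet n → ESet n → Set
T ⊆ S = ∀ v t → T v t ≡ true → S v t ≡ true

NonEmpty : ∀ {n} → ESet n → Set
NonEmpty S = ∃ λ v → ∃ λ t → S v t ≡ true

ProperSubset : ∀ {n} → ESet n → ESet n → Set
ProperSubset T S = T ⊆ S × (∃ λ v → ∃ λ t → S v t ≡ true × T v t ≡ false)

full : ∀ {n} → ESet n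
full v t = true

compl : ∀ {n} → ESet n → ESet n
compl S v t = not (S v t)

Dependent : ∀ {n} → Graph n → ESet n → Set
Dependent G T = ∃ λ U → U ⊆ T × NonEmpty U × IsZeroVec (colSum G U)

Independent : ∀ {n} → Graph n → ESet n → Set
Independent G T = ¬ Dependent G T

HasRank : ∀ {n} → Graph n → ESet n → ℕ → Set
HasRank G S k =
  (∃ λ T → T ⊆ S × Independent G T × card T ≡ k) ×
  (∀ T → T ⊆ S → Independent G T → card T ≤ k)

Circuit : ∀ {n} → Graph n → ESet n → Set
Circuit G C = Dependent G C × (∀ D → ProperSubset D C → Independent G D)

Transversal : ∀ {n} → ESet n → Set
Transversal {n} T = ∀ (v : Fin n) → ∃ λ t → T v t ≡ true × (∀ s → T v s ≡ true → s ≡ t)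

TransverseCircuit : ∀ {n} → Graph n → ESet n → Set
TransverseCircuit G C = Circuit G C × (∃ λ T → Transversal T × C ⊆ T)

IsMinTransverseCircuitSize : ∀ {n} → Graph n → ℕ → Set
IsMinTransverseCircuitSize G q =
  (∃ λ C → TransverseCircuit G C × card C ≡ q) ×
  (∀ C → TransverseCircuit G C → q ≤ card C)

-- S is a vertical k-separation: λ(S) < k, r(S) ≥ k, r(W - S) ≥ k,
-- where λ(S) = r(S) + r(W - S) - r(M), so λ(S) < k ⟺ r(S) + r(W-S) < k + r(M).
VerticalSeparation : ∀ {n} → Graph n → ℕ → ESet n → Set
VerticalSeparation G k S =
  ∃ λ a → ∃ λ b → ∃ λ r →
    HasRank G S a × HasRank G (compl S) b × HasRank G full r ×
    a + b < k + r × k ≤ a × k ≤ b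

HasVerticalSeparation : ∀ {n} → Graph n → ℕ → Set
HasVerticalSeparation G k = ∃ λ S → VerticalSeparation G k S

-- κ(M) = min ({k | vertical k-separation exists} ∪ {r(M)})
IsKappa : ∀ {n} → Graph n → ℕ → Set
IsKappa G κ = ∃ λ r → HasRank G full r ×
  ((κ ≡ r ⊎ HasVerticalSeparation G κ) ×
   κ ≤ r × (∀ k → HasVerticalSeparation G k → κ ≤ k))

module Submission where

-- A smallest transverse circuit contains a nonempty set D, |D| ≤ q,
-- whose columns sum to zero and which meets every vertex triple at most once.
-- Write that column sum as a + A b, where a and b are the coefficient vectors
-- of the identity part and of the adjacency part of (I A A+I); then a = A b
-- and b ≠ 0, so fix a vertex y with b(y) = 1. Let S be the union of the
-- triples of the vertices met by D.
--  * S is spanned by the φ-elements of these vertices and their χ-elements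
--    other than χ(y), because a = A b expresses χ(y) through them;
--    hence r(S) ≤ 2|D| - 1 ≤ 2q - 1.
--  * Every column outside S is orthogonal to b, and the orthogonal
--    complement of b is spanned by n - 1 vectors; hence r(W - S) ≤ n - 1,
--    while the φ-elements show r(M) ≥ n.
-- Both rank bounds are instances of the Steinitz exchange lemma (an
-- independent set whose vectors are combinations of vectors indexed by J has
-- at most |J| elements), which is proved first, after the GF(2) bookkeeping;
-- ranks exist by exhaustive search over the subsets of the ground set.
-- With a = r(S), b = r(W - S) and r = r(M), the number k = a + b + 1 - r
-- makes S a vertical k-separation with k ≤ 2q - 1, so κ(M) ≤ 2q - 1.

open import Defs
open import Data.Nat using (ℕ; zero; suc; _+_; _*_; _∸_; _<_; _≤_; z≤n; s≤s)
open import Data.Nat.Properties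
  using (≤-refl; ≤-reflexive; ≤-trans; +-mono-≤; +-monoˡ-≤; +-comm; +-suc; +-identityʳ;
         n≤1+n; suc-injective; 0≢1+n; m≤n+m∸n; m≤n+o⇒m∸n≤o; m≤n⇒m<n∨m≡n)
import Data.Nat.Properties as ℕ
open import Data.Fin using (Fin; zero; suc)
open import Data.Fin.Properties using (_≟_; any?; all?)
import Data.Fin.Properties as Fin
open import Data.Bool using (Bool; true; false; _∧_; _∨_; _xor_; not; T)
import Data.Bool.Properties
open Data.Bool.Properties
  using (∧-comm; ∧-assoc; ∧-identityʳ; ∧-distribˡ-xor; ∧-distribʳ-xor; xor-assoc; xor-comm; xor-identityʳ; xor-same)
  renaming (_≟_ to _≟ᵇ_)
open import Data.Product using (∃; _×_; _,_; proj₁; proj₂)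
open import Data.Sum using (_⊎_; inj₁; inj₂)
open import Data.Empty using (⊥; ⊥-elim)
open import Data.Unit using (tt)
open import Data.Vec.Functional using (_∷_)
open import Relation.Binary.PropositionalEquality
  using (_≡_; _≢_; refl; trans; cong; cong₂; subst; module ≡-Reasoning)
  renaming (sym to ≡-sym)
open import Relation.Nullary using (¬_; Dec; yes; no; ¬?)
open import Relation.Nullary.Decidable using (⌊_⌋; isYes; toWitness; _×-dec_; _→-dec_)
open import Algebra.Bundles using (CommutativeRing)
open import Algebra.Properties.CommutativeSemigroup ℕ.+-commutativeSemigroup
  using () renaming (interchange to +-interchange)
open import Algebra.Properties.CommutativeSemigroup
    (CommutativeRing.+-commutativeSemigroup Data.Bool.Properties.xor-∧-commutativeRing)
  using () renaming (interchange to xor-interchange)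

∀-Bool? : ∀ {p} {P : Bool → Set p} → (∀ b → Dec (P b)) → Dec (∀ b → P b)
∀-Bool? d with d false | d true
... | yes f | yes t = yes λ { false → f ; true → t }
... | no ¬f | _     = no λ all → ¬f (all false)
... | _     | no ¬t = no λ all → ¬t (all true)

by-table₃ : {f g : Bool → Bool → Bool → Bool} →
  T (isYes (∀-Bool? λ a → ∀-Bool? λ b → ∀-Bool? λ c → f a b c ≟ᵇ g a b c)) →
  ∀ a b c → f a b c ≡ g a b c
by-table₃ ok = toWitness ok

by-table₄ : {f g : Bool → Bool → Bool → Bool → Bool} →
  T (isYes (∀-Bool? λ a → ∀-Bool? λ b → ∀-Bool? λ c → ∀-Bool? λ d → f a b c d ≟ᵇ g a b c d)) →
  ∀ a b c d → f a b c d ≡ g a b c d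
by-table₄ ok = toWitness ok

by-table₅ : {f g : Bool → Bool → Bool → Bool → Bool → Bool} →
  T (isYes (∀-Bool? λ a → ∀-Bool? λ b → ∀-Bool? λ c → ∀-Bool? λ d → ∀-Bool? λ e →
            f a b c d e ≟ᵇ g a b c d e)) →
  ∀ a b c d e → f a b c d e ≡ g a b c d e
by-table₅ ok = toWitness ok

xor-solve : ∀ a s x → a xor s ≡ x → a ≡ x xor s
xor-solve a s x e = begin
  a                ≡⟨ ≡-sym (xor-identityʳ a) ⟩
  a xor false      ≡⟨ cong (a xor_) (≡-sym (xor-same s)) ⟩
  a xor (s xor s)  ≡⟨ ≡-sym (xor-assoc a s s) ⟩
  (a xor s) xor s  ≡⟨ cong (_xor s) e ⟩
  x xor s          ∎
  where open ≡-Reasoning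

false≢true : false ≢ true
false≢true ()

≢true⇒false : ∀ {x} → x ≢ true → x ≡ false
≢true⇒false {false} _ = refl
≢true⇒false {true} x≢true = ⊥-elim (x≢true refl)

∧-true⇒left : ∀ a b → a ∧ b ≡ true → a ≡ true
∧-true⇒left true b _ = refl

∧-not-true : ∀ a e → a ∧ not e ≡ true → a ≡ true × e ≡ false
∧-not-true true false _ = refl , refl

xor-∧-true : ∀ a c b → a xor (c ∧ b) ≡ true → a ≡ true ⊎ b ≡ true
xor-∧-true true c b _ = inj₁ refl
xor-∧-true false true true _ = inj₂ refl

δ : ∀ {n} → Fin n → Fin n → Bool
δ a b = ⌊ a ≟ b ⌋

δ-refl : ∀ {n} (a : Fin n) → δ a a ≡ true
δ-refl a with a ≟ a
... | yes _ = refl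
... | no a≢a = ⊥-elim (a≢a refl)

δ-sym : ∀ {n} (a b : Fin n) → δ a b ≡ δ b a
δ-sym a b with a ≟ b | b ≟ a
... | yes _ | yes _ = refl
... | no _  | no _  = refl
... | yes a≡b | no b≢a = ⊥-elim (b≢a (≡-sym a≡b))
... | no a≢b | yes b≡a = ⊥-elim (a≢b (≡-sym b≡a))

δ-suc : ∀ {n} (a b : Fin n) → δ (suc a) (suc b) ≡ δ a b
δ-suc a b with a ≟ b
... | yes refl = refl
... | no _ = refl

δ-true : ∀ {n} {a b : Fin n} → δ a b ≡ true → a ≡ b
δ-true {a = a} {b} e with a ≟ b
... | yes a≡b = a≡b

δ-false : ∀ {n} {a b : Fin n} → a ≢ b → δ a b ≡ false
δ-false {a = a} {b} a≢b with a ≟ b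
... | yes a≡b = ⊥-elim (a≢b a≡b)
... | no _ = refl

xorFin-cong : ∀ m {f g : Fin m → Bool} → (∀ i → f i ≡ g i) → xorFin m f ≡ xorFin m g
xorFin-cong zero e = refl
xorFin-cong (suc m) e = cong₂ _xor_ (e zero) (xorFin-cong m (λ i → e (suc i)))

xorFin-false : ∀ m {f : Fin m → Bool} → (∀ i → f i ≡ false) → xorFin m f ≡ false
xorFin-false zero e = refl
xorFin-false (suc m) e = cong₂ _xor_ (e zero) (xorFin-false m (λ i → e (suc i)))

xorFin-xor : ∀ m (f g : Fin m → Bool) → xorFin m (λ i → f i xor g i) ≡ xorFin m f xor xorFin m g
xorFin-xor zero f g = refl
xorFin-xor (suc m) f g =
  trans (cong ((f zero xor g zero) xor_) (xorFin-xor m (λ i → f (suc i)) (λ i → g (suc i))))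
        (xor-interchange (f zero) (g zero) _ _)

xorFin-∧ˡ : ∀ m (f : Fin m → Bool) b → xorFin m (λ i → b ∧ f i) ≡ b ∧ xorFin m f
xorFin-∧ˡ zero f b = ∧-comm false b
xorFin-∧ˡ (suc m) f b =
  trans (cong ((b ∧ f zero) xor_) (xorFin-∧ˡ m (λ i → f (suc i)) b))
        (≡-sym (∧-distribˡ-xor b (f zero) _))

xorFin-∧ʳ : ∀ m (f : Fin m → Bool) b → xorFin m (λ i → f i ∧ b) ≡ xorFin m f ∧ b
xorFin-∧ʳ zero f b = refl
xorFin-∧ʳ (suc m) f b =
  trans (cong ((f zero ∧ b) xor_) (xorFin-∧ʳ m (λ i → f (suc i)) b))
        (≡-sym (∧-distribʳ-xor b (f zero) _))

xorFin-δ : ∀ m (y : Fin m) (f : Fin m → Bool) → xorFin m (λ i → δ i y ∧ f i) ≡ f y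
xorFin-δ (suc m) zero f =
  trans (cong (f zero xor_) (xorFin-false m (λ i → refl))) (xor-identityʳ (f zero))
xorFin-δ (suc m) (suc y) f =
  trans (xorFin-cong m (λ i → cong (_∧ f (suc i)) (δ-suc i y))) (xorFin-δ m y (λ i → f (suc i)))

xorFin-δ′ : ∀ m (y : Fin m) (f : Fin m → Bool) → xorFin m (λ i → δ y i ∧ f i) ≡ f y
xorFin-δ′ m y f = trans (xorFin-cong m (λ i → cong (_∧ f i) (δ-sym y i))) (xorFin-δ m y f)

xorFin-split : ∀ m (y : Fin m) (f : Fin m → Bool) →
  xorFin m f ≡ f y xor xorFin m (λ i → not (δ i y) ∧ f i)
xorFin-split m y f =
  trans (xorFin-cong m (λ i → split (δ i y) (f i)))
    (trans (xorFin-xor m (λ i → δ i y ∧ f i) (λ i → not (δ i y) ∧ f i))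
      (cong (_xor xorFin m (λ i → not (δ i y) ∧ f i)) (xorFin-δ m y f)))
  where
  split : ∀ d a → a ≡ (d ∧ a) xor (not d ∧ a)
  split true a = ≡-sym (xor-identityʳ a)
  split false a = refl

Σᴱ : ∀ {n} → ESet n → Bool
Σᴱ {n} f = xorFin n (λ v → xorFin 3 (f v))

Σᴱ-cong : ∀ {n} {f g : ESet n} → (∀ v t → f v t ≡ g v t) → Σᴱ f ≡ Σᴱ g
Σᴱ-cong {n} e = xorFin-cong n (λ v → xorFin-cong 3 (e v))

Σᴱ-false : ∀ {n} {f : ESet n} → (∀ v t → f v t ≡ false) → Σᴱ f ≡ false
Σᴱ-false {n} e = xorFin-false n (λ v → xorFin-false 3 (e v))

Σᴱ-xor : ∀ {n} (f g : ESet n) → Σᴱ (λ v t → f v t xor g v t) ≡ Σᴱ f xor Σᴱ g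
Σᴱ-xor {n} f g = trans (xorFin-cong n (λ v → xorFin-xor 3 (f v) (g v))) (xorFin-xor n _ _)

Σᴱ-∧ˡ : ∀ {n} (f : ESet n) b → Σᴱ (λ v t → b ∧ f v t) ≡ b ∧ Σᴱ f
Σᴱ-∧ˡ {n} f b = trans (xorFin-cong n (λ v → xorFin-∧ˡ 3 (f v) b)) (xorFin-∧ˡ n _ b)

Σᴱ-∧ʳ : ∀ {n} (f : ESet n) b → Σᴱ (λ v t → f v t ∧ b) ≡ Σᴱ f ∧ b
Σᴱ-∧ʳ {n} f b = trans (xorFin-cong n (λ v → xorFin-∧ʳ 3 (f v) b)) (xorFin-∧ʳ n _ b)

single : ∀ {n} → Fin n → Fin 3 → ESet n
single a b v t = δ v a ∧ δ t b

Σᴱ-single : ∀ {n} (a : Fin n) (b : Fin 3) (f : ESet n) → Σᴱ (λ v t → single a b v t ∧ f v t) ≡ f a b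
Σᴱ-single {n} a b f = begin
  xorFin n (λ v → xorFin 3 (λ t → (δ v a ∧ δ t b) ∧ f v t))
    ≡⟨ xorFin-cong n (λ v → xorFin-cong 3 (λ t → ∧-assoc (δ v a) (δ t b) (f v t))) ⟩
  xorFin n (λ v → xorFin 3 (λ t → δ v a ∧ (δ t b ∧ f v t)))
    ≡⟨ xorFin-cong n (λ v → xorFin-∧ˡ 3 (λ t → δ t b ∧ f v t) (δ v a)) ⟩
  xorFin n (λ v → δ v a ∧ xorFin 3 (λ t → δ t b ∧ f v t))
    ≡⟨ xorFin-cong n (λ v → cong (δ v a ∧_) (xorFin-δ 3 b (f v))) ⟩
  xorFin n (λ v → δ v a ∧ f v b)
    ≡⟨ xorFin-δ n a (λ v → f v b) ⟩
  f a b ∎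
  where open ≡-Reasoning

single-self : ∀ {n} (a : Fin n) (b : Fin 3) → single a b a b ≡ true
single-self a b rewrite δ-refl a | δ-refl b = refl

single-true : ∀ {n} {a v : Fin n} {b t : Fin 3} → single a b v t ≡ true → v ≡ a × t ≡ b
single-true {a = a} {v} {b} {t} e with δ v a in e₁ | δ t b in e₂
single-true refl | true | true = δ-true e₁ , δ-true e₂

single-⊆ : ∀ {n} {I : ESet n} {a b} → I a b ≡ true → single a b ⊆ I
single-⊆ {a = a} {b} Iab v t e with single-true {a = a} {v} {b} {t} e
... | refl , refl = Iab

single-nonempty : ∀ {n} (a : Fin n) (b : Fin 3) → NonEmpty (single a b)
single-nonempty a b = a , b , single-self a b

remove : ∀ {n} → ESet n → Fin n → Fin 3 → ESet n
remove I a b v t = I v t ∧ not (single a b v t)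

∃-ground? : ∀ {n} (P : Fin n → Fin 3 → Set) → (∀ v t → Dec (P v t)) → Dec (∃ λ v → ∃ λ t → P v t)
∃-ground? P P? = any? (λ v → any? (λ t → P? v t))

sumFin-cong : ∀ m {f g : Fin m → ℕ} → (∀ i → f i ≡ g i) → sumFin m f ≡ sumFin m g
sumFin-cong zero e = refl
sumFin-cong (suc m) e = cong₂ _+_ (e zero) (sumFin-cong m (λ i → e (suc i)))

sumFin-zero : ∀ m {f : Fin m → ℕ} → (∀ i → f i ≡ 0) → sumFin m f ≡ 0
sumFin-zero zero e = refl
sumFin-zero (suc m) e = cong₂ _+_ (e zero) (sumFin-zero m (λ i → e (suc i)))

sumFin-mono : ∀ m {f g : Fin m → ℕ} → (∀ i → f i ≤ g i) → sumFin m f ≤ sumFin m g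
sumFin-mono zero e = z≤n
sumFin-mono (suc m) e = +-mono-≤ (e zero) (sumFin-mono m (λ i → e (suc i)))

sumFin-+ : ∀ m (f g : Fin m → ℕ) → sumFin m (λ i → f i + g i) ≡ sumFin m f + sumFin m g
sumFin-+ zero f g = refl
sumFin-+ (suc m) f g = begin
  (f zero + g zero) + sumFin m (λ i → f (suc i) + g (suc i))
    ≡⟨ cong ((f zero + g zero) +_) (sumFin-+ m (λ i → f (suc i)) (λ i → g (suc i))) ⟩
  (f zero + g zero) + (F + G)
    ≡⟨ +-interchange (f zero) (g zero) F G ⟩
  (f zero + F) + (g zero + G) ∎
  where
  open ≡-Reasoning
  F G : ℕ
  F = sumFin m (λ i → f (suc i))
  G = sumFin m (λ i → g (suc i))

sumFin-remove : ∀ m (y : Fin m) (f g : Fin m → ℕ) → f y ≡ suc (g y) → (∀ i → i ≢ y → f i ≡ g i) →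
  sumFin m f ≡ suc (sumFin m g)
sumFin-remove (suc m) zero f g fy others = cong₂ _+_ fy (sumFin-cong m (λ i → others (suc i) (λ ())))
sumFin-remove (suc m) (suc y) f g fy others =
  trans (cong₂ _+_ (others zero (λ ()))
          (sumFin-remove m y (λ i → f (suc i)) (λ i → g (suc i)) fy
            (λ i i≢y → others (suc i) (λ e → i≢y (Fin.suc-injective e)))))
        (+-suc (g zero) _)

sumFin-δ : ∀ m (y : Fin m) → sumFin m (λ v → b2n (δ v y)) ≡ 1
sumFin-δ m y =
  trans (sumFin-remove m y _ (λ _ → 0) (cong b2n (δ-refl y)) (λ i i≢y → cong b2n (δ-false i≢y)))
        (cong suc (sumFin-zero m (λ _ → refl)))

card-cong : ∀ {n} {U U′ : ESet n} → (∀ v t → U v t ≡ U′ v t) → card U ≡ card U′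
card-cong {n} e = sumFin-cong n (λ v → sumFin-cong 3 (λ t → cong b2n (e v t)))

card-empty : ∀ {n} {U : ESet n} → (∀ v t → U v t ≡ false) → card U ≡ 0
card-empty {n} e = sumFin-zero n (λ v → sumFin-zero 3 (λ t → cong b2n (e v t)))

card-mono : ∀ {n} {U U′ : ESet n} → U ⊆ U′ → card U ≤ card U′
card-mono {n} {U} {U′} U⊆U′ = sumFin-mono n (λ v → sumFin-mono 3 (λ t → b2n-mono (U v t) (U′ v t) (U⊆U′ v t)))
  where
  b2n-mono : ∀ x y → (x ≡ true → y ≡ true) → b2n x ≤ b2n y
  b2n-mono true y x⇒y rewrite x⇒y refl = ≤-refl
  b2n-mono false y _ = z≤n

card-remove : ∀ {n} (I : ESet n) a b → I a b ≡ true → card I ≡ suc (card (remove I a b))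
card-remove {n} I a b Iab = sumFin-remove n a _ _ atVertex otherVertex
  where
  atVertex : sumFin 3 (λ t → b2n (I a t)) ≡ suc (sumFin 3 (λ t → b2n (remove I a b a t)))
  atVertex = sumFin-remove 3 b _ _ atElement otherElement
    where
    atElement : b2n (I a b) ≡ suc (b2n (remove I a b a b))
    atElement rewrite Iab | single-self a b = refl
    otherElement : ∀ t → t ≢ b → b2n (I a t) ≡ b2n (remove I a b a t)
    otherElement t t≢b rewrite δ-false t≢b | ∧-comm (δ a a) false = cong b2n (≡-sym (∧-identityʳ (I a t)))
  otherVertex : ∀ v → v ≢ a → sumFin 3 (λ t → b2n (I v t)) ≡ sumFin 3 (λ t → b2n (remove I a b v t))
  otherVertex v v≢a rewrite δ-false v≢a = sumFin-cong 3 (λ t → cong b2n (≡-sym (∧-identityʳ (I v t))))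

card-remove-suc : ∀ {n} (J : ESet n) {k a b} → card J ≡ suc k → J a b ≡ true → card (remove J a b) ≡ k
card-remove-suc J {a = a} {b} |J|≡1+k Jab = suc-injective (trans (≡-sym (card-remove J a b Jab)) |J|≡1+k)

card-zero⇒empty : ∀ {n} (J : ESet n) → card J ≡ 0 → ∀ v t → J v t ≡ false
card-zero⇒empty J c v t with J v t in Jvt
... | false = refl
... | true = ⊥-elim (0≢1+n (trans (≡-sym c) (card-remove J v t Jvt)))

card-suc⇒element : ∀ {n} (J : ESet n) {k} → card J ≡ suc k → ∃ λ v → ∃ λ t → J v t ≡ true
card-suc⇒element J c with ∃-ground? (λ v t → J v t ≡ true) (λ v t → J v t ≟ᵇ true)
... | yes element = element
... | no none = ⊥-elim (0≢1+n (trans (≡-sym (card-empty (λ v t → ≢true⇒false (λ p → none (v , t , p))))) c))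

Family : ℕ → ℕ → Set
Family n m = Fin n → Fin 3 → GF2Vec m

-- The sum of the vectors h v t for (v , t) ∈ U; colSum G is combo (column G).
combo : ∀ {n m} → Family n m → ESet n → GF2Vec m
combo h U w = Σᴱ (λ v t → U v t ∧ h v t w)

module _ {n m : ℕ} (h : Family n m) where

  combo-cong : ∀ {U U′ : ESet n} → (∀ v t → U v t ≡ U′ v t) → ∀ w → combo h U w ≡ combo h U′ w
  combo-cong e w = Σᴱ-cong (λ v t → cong (_∧ h v t w) (e v t))

  combo-empty : ∀ {U : ESet n} → (∀ v t → U v t ≡ false) → ∀ w → combo h U w ≡ false
  combo-empty e w = Σᴱ-false (λ v t → cong (_∧ h v t w) (e v t))

  combo-single : ∀ a b w → combo h (single a b) w ≡ h a b w
  combo-single a b w = Σᴱ-single a b (λ v t → h v t w)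

  combo-lin : ∀ (U U′ : ESet n) c w →
    combo h (λ v t → U v t xor (c ∧ U′ v t)) w ≡ combo h U w xor (c ∧ combo h U′ w)
  combo-lin U U′ c w = begin
    Σᴱ (λ v t → (U v t xor (c ∧ U′ v t)) ∧ h v t w)
      ≡⟨ Σᴱ-cong (λ v t → distrib (U v t) c (U′ v t) (h v t w)) ⟩
    Σᴱ (λ v t → (U v t ∧ h v t w) xor (c ∧ (U′ v t ∧ h v t w)))
      ≡⟨ Σᴱ-xor (λ v t → U v t ∧ h v t w) (λ v t → c ∧ (U′ v t ∧ h v t w)) ⟩
    combo h U w xor Σᴱ (λ v t → c ∧ (U′ v t ∧ h v t w))
      ≡⟨ cong (combo h U w xor_) (Σᴱ-∧ˡ (λ v t → U′ v t ∧ h v t w) c) ⟩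
    combo h U w xor (c ∧ combo h U′ w) ∎
    where
    open ≡-Reasoning
    distrib : ∀ u c u′ x → (u xor (c ∧ u′)) ∧ x ≡ (u ∧ x) xor (c ∧ (u′ ∧ x))
    distrib = by-table₄ tt

combo-shear : ∀ {n m} (g : Family n m) (c : ESet n) (k : GF2Vec m) (U : ESet n) w →
  combo (λ v t w′ → g v t w′ xor (c v t ∧ k w′)) U w ≡ combo g U w xor (Σᴱ (λ v t → U v t ∧ c v t) ∧ k w)
combo-shear g c k U w = begin
  Σᴱ (λ v t → U v t ∧ (g v t w xor (c v t ∧ k w)))
    ≡⟨ Σᴱ-cong (λ v t → distrib (U v t) (g v t w) (c v t) (k w)) ⟩
  Σᴱ (λ v t → (U v t ∧ g v t w) xor ((U v t ∧ c v t) ∧ k w))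
    ≡⟨ Σᴱ-xor (λ v t → U v t ∧ g v t w) (λ v t → (U v t ∧ c v t) ∧ k w) ⟩
  combo g U w xor Σᴱ (λ v t → (U v t ∧ c v t) ∧ k w)
    ≡⟨ cong (combo g U w xor_) (Σᴱ-∧ʳ (λ v t → U v t ∧ c v t) (k w)) ⟩
  combo g U w xor (Σᴱ (λ v t → U v t ∧ c v t) ∧ k w) ∎
  where
  open ≡-Reasoning
  distrib : ∀ u x c k → u ∧ (x xor (c ∧ k)) ≡ (u ∧ x) xor ((u ∧ c) ∧ k)
  distrib = by-table₄ tt

-- The Steinitz exchange lemma, for GF(2)-vectors of any length m.

module _ {n m : ℕ} where

  LinIndep : ESet n → Family n m → Set
  LinIndep I g = ∀ U → U ⊆ I → NonEmpty U → ¬ IsZeroVec (combo g U)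

  Writes : ESet n → Family n m → Family n m → (Fin n → Fin 3 → ESet n) → Fin n → Fin 3 → Set
  Writes J h g sel v t = sel v t ⊆ J × (∀ w → g v t w ≡ combo h (sel v t) w)

  Represents : ESet n → Family n m → ESet n → Family n m → (Fin n → Fin 3 → ESet n) → Set
  Represents J h I g sel = ∀ v t → I v t ≡ true → Writes J h g sel v t

  represents-⊆ : ∀ {J h I T g sel} → T ⊆ I → Represents J h I g sel → Represents J h T g sel
  represents-⊆ T⊆I rep v t Tvt = rep v t (T⊆I v t Tvt)

  -- Over an empty J only the zero vector is represented, so an independent
  -- set represented over an empty J is empty.
  represented-over-empty : ∀ {J h I g sel} → (∀ v t → J v t ≡ false) →
    LinIndep I g → Represents J h I g sel → ∀ v t → I v t ≡ false
  represented-over-empty {J} {h} {I} {g} {sel} J-empty ind rep v t with I v t in Ivt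
  ... | false = refl
  ... | true = ⊥-elim (ind (single v t) (single-⊆ Ivt) (single-nonempty v t) vanishes)
    where
    sel-empty : ∀ v′ t′ → sel v t v′ t′ ≡ false
    sel-empty v′ t′ = ≢true⇒false λ p → false≢true (trans (≡-sym (J-empty v′ t′)) (proj₁ (rep v t Ivt) v′ t′ p))
    vanishes : IsZeroVec (combo g (single v t))
    vanishes w = begin
      combo g (single v t) w  ≡⟨ combo-single g v t w ⟩
      g v t w                 ≡⟨ proj₂ (rep v t Ivt) w ⟩
      combo h (sel v t) w     ≡⟨ combo-empty h sel-empty w ⟩
      false                   ∎
      where open ≡-Reasoning

  drop-unused : ∀ {J h I g sel} a b → (∀ v t → I v t ≡ true → sel v t a b ≡ false) →
    Represents J h I g sel → Represents (remove J a b) h I g sel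
  drop-unused {J} {sel = sel} a b unused rep v t Ivt = inside , proj₂ (rep v t Ivt)
    where
    inside : sel v t ⊆ remove J a b
    inside v′ t′ p with single a b v′ t′ in e
    ... | false = trans (∧-identityʳ _) (proj₁ (rep v t Ivt) v′ t′ p)
    ... | true with single-true {a = a} {v′} {b} {t′} e
    ...   | refl , refl = ⊥-elim (false≢true (trans (≡-sym (unused v t Ivt)) p))

  -- Let the representation of the pivot (a₀ , b₀) ∈ I use
  -- (a , b) ∈ J. Adding g a₀ b₀ to every vector whose representation uses
  -- (a , b) frees the remaining vectors of I from (a , b), and keeps them
  -- independent.
  module Exchange {J : ESet n} {h : Family n m} {I : ESet n} {g : Family n m}
                  {sel : Fin n → Fin 3 → ESet n} (a : Fin n) (b : Fin 3)
                  (a₀ : Fin n) (b₀ : Fin 3) (Ia₀b₀ : I a₀ b₀ ≡ true) where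

    uses : ESet n
    uses v t = sel v t a b

    g′ : Family n m
    g′ v t w = g v t w xor (uses v t ∧ g a₀ b₀ w)

    sel′ : Fin n → Fin 3 → ESet n
    sel′ v t v′ t′ = sel v t v′ t′ xor (uses v t ∧ sel a₀ b₀ v′ t′)

    exchange-represents : uses a₀ b₀ ≡ true → Represents J h I g sel →
      Represents (remove J a b) h (remove I a₀ b₀) g′ sel′
    exchange-represents pivot-uses rep v t I′vt = inside , equation
      where
      Ivt : I v t ≡ true
      Ivt = proj₁ (∧-not-true (I v t) _ I′vt)
      cancels : ∀ c → c xor (c ∧ true) ≡ false
      cancels true = refl
      cancels false = refl
      inside : sel′ v t ⊆ remove J a b
      inside v′ t′ p with single a b v′ t′ in e
      ... | true with single-true {a = a} {v′} {b} {t′} e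
      ...   | refl , refl =
              ⊥-elim (false≢true (trans (≡-sym (trans (cong (λ z → uses v t xor (uses v t ∧ z)) pivot-uses)
                                                        (cancels (uses v t)))) p))
      inside v′ t′ p | false with xor-∧-true (sel v t v′ t′) (uses v t) (sel a₀ b₀ v′ t′) p
      ... | inj₁ q = trans (∧-identityʳ _) (proj₁ (rep v t Ivt) v′ t′ q)
      ... | inj₂ q = trans (∧-identityʳ _) (proj₁ (rep a₀ b₀ Ia₀b₀) v′ t′ q)
      equation : ∀ w → g′ v t w ≡ combo h (sel′ v t) w
      equation w =
        trans (cong₂ (λ x y → x xor (uses v t ∧ y)) (proj₂ (rep v t Ivt) w) (proj₂ (rep a₀ b₀ Ia₀b₀) w))
              (≡-sym (combo-lin h (sel v t) (sel a₀ b₀) (uses v t) w))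

    -- A vanishing g′-combination of U ⊆ I - (a₀ , b₀) is a vanishing
    -- g-combination of U plus a multiple of (a₀ , b₀).
    exchange-independent : LinIndep I g → LinIndep (remove I a₀ b₀) g′
    exchange-independent ind U U⊆I′ (v₀ , t₀ , Uv₀t₀) g′-vanishes = ind U₂ U₂⊆I U₂-nonempty g-vanishes
      where
      γ : Bool
      γ = Σᴱ (λ v t → U v t ∧ uses v t)
      U₂ : ESet n
      U₂ v t = U v t xor (γ ∧ single a₀ b₀ v t)
      U₂⊆I : U₂ ⊆ I
      U₂⊆I v t p with xor-∧-true (U v t) γ (single a₀ b₀ v t) p
      ... | inj₁ q = proj₁ (∧-not-true _ _ (U⊆I′ v t q))
      ... | inj₂ q = single-⊆ Ia₀b₀ v t q
      U₂-nonempty : NonEmpty U₂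
      U₂-nonempty = v₀ , t₀ , trans (cong₂ (λ x y → x xor (γ ∧ y)) Uv₀t₀ (proj₂ (∧-not-true _ _ (U⊆I′ v₀ t₀ Uv₀t₀))))
                                    (cong (true xor_) (∧-comm γ false))
      g-vanishes : IsZeroVec (combo g U₂)
      g-vanishes w = begin
        combo g U₂ w                                       ≡⟨ combo-lin g U (single a₀ b₀) γ w ⟩
        combo g U w xor (γ ∧ combo g (single a₀ b₀) w)    ≡⟨ cong (λ z → combo g U w xor (γ ∧ z)) (combo-single g a₀ b₀ w) ⟩
        combo g U w xor (γ ∧ g a₀ b₀ w)                   ≡⟨ ≡-sym (combo-shear g uses (g a₀ b₀) U w) ⟩
        combo g′ U w                                       ≡⟨ g′-vanishes w ⟩
        false                                              ∎
        where open ≡-Reasoning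

  steinitz : ∀ k (J : ESet n) (h : Family n m) → card J ≡ k →
    ∀ I g sel → LinIndep I g → Represents J h I g sel → card I ≤ k
  steinitz zero J h |J|≡0 I g sel ind rep =
    ≤-reflexive (card-empty (represented-over-empty {h = h} {sel = sel} (card-zero⇒empty J |J|≡0) ind rep))
  steinitz (suc k) J h |J|≡1+k I g sel ind rep
    with card-suc⇒element J |J|≡1+k
  ... | a , b , Jab
    with ∃-ground? (λ v t → I v t ≡ true × sel v t a b ≡ true) (λ v t → (I v t ≟ᵇ true) ×-dec (sel v t a b ≟ᵇ true))
  ... | no unused =
        ≤-trans (steinitz k (remove J a b) h (card-remove-suc J |J|≡1+k Jab) I g sel ind
                  (drop-unused {h = h} a b (λ v t Ivt → ≢true⇒false (λ p → unused (v , t , Ivt , p))) rep))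
                (n≤1+n k)
  ... | yes (a₀ , b₀ , Ia₀b₀ , pivot-uses) =
        subst (_≤ suc k) (≡-sym (card-remove I a₀ b₀ Ia₀b₀))
          (s≤s (steinitz k (remove J a b) h (card-remove-suc J |J|≡1+k Jab) (remove I a₀ b₀) g′ sel′
                  (exchange-independent ind) (exchange-represents pivot-uses rep)))
    where open Exchange {J} {h} {I} {g} {sel} a b a₀ b₀ Ia₀b₀

-- Ranks exist: independence is decidable and subsets can be searched.

Searchable : (X : Set) → (X → X → Set) → Set₁
Searchable X R = ∀ (P : X → Set) → (∀ x y → R x y → P x → P y) → (∀ x → Dec (P x)) → Dec (∃ P)

Bool-searchable : Searchable Bool _≡_
Bool-searchable P _ P? with P? true | P? false
... | yes p | _     = yes (true , p)
... | no _  | yes p = yes (false , p)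
... | no ¬t | no ¬f = no λ { (true , p) → ¬t p ; (false , p) → ¬f p }

Fin→-searchable : ∀ {X : Set} {R : X → X → Set} → (∀ x → R x x) → Searchable X R →
  ∀ k → Searchable (Fin k → X) (λ f g → ∀ i → R (f i) (g i))
Fin→-searchable R-refl search zero P respects P? with P? (λ ())
... | yes p = yes (_ , p)
... | no ¬p = no λ { (f , pf) → ¬p (respects f _ (λ ()) pf) }
Fin→-searchable {X} {R} R-refl search (suc k) P respects P? with search HasTail respectsHead HasTail?
  where
  HasTail : X → Set
  HasTail x = ∃ λ f → P (x ∷ f)
  respectsHead : ∀ x y → R x y → HasTail x → HasTail y
  respectsHead x y r (f , p) = f , respects (x ∷ f) (y ∷ f) (λ { zero → r ; (suc i) → R-refl (f i) }) p
  HasTail? : ∀ x → Dec (HasTail x)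
  HasTail? x = Fin→-searchable R-refl search k (λ f → P (x ∷ f))
    (λ f g e p → respects (x ∷ f) (x ∷ g) (λ { zero → R-refl x ; (suc i) → e i }) p) (λ f → P? (x ∷ f))
... | yes (x , f , p) = yes (x ∷ f , p)
... | no none = no λ { (f , p) → none (f zero , (λ i → f (suc i)) ,
        respects f _ (λ { zero → R-refl (f zero) ; (suc i) → R-refl (f (suc i)) }) p) }

ESet-searchable : ∀ n → Searchable (ESet n) (λ U U′ → ∀ v t → U v t ≡ U′ v t)
ESet-searchable n = Fin→-searchable (λ _ _ → refl) (Fin→-searchable (λ _ → refl) Bool-searchable 3) n

_⊆?_ : ∀ {n} (U T : ESet n) → Dec (U ⊆ T)
U ⊆? T = all? (λ v → all? (λ t → (U v t ≟ᵇ true) →-dec (T v t ≟ᵇ true)))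

dependent? : ∀ {n} (G : Graph n) (T : ESet n) → Dec (Dependent G T)
dependent? {n} G T = ESet-searchable n _ respects witness?
  where
  respects : ∀ U U′ → (∀ v t → U v t ≡ U′ v t) →
    U ⊆ T × NonEmpty U × IsZeroVec (colSum G U) → U′ ⊆ T × NonEmpty U′ × IsZeroVec (colSum G U′)
  respects U U′ e (U⊆T , (v , t , p) , zero-sum) =
    (λ v t q → U⊆T v t (trans (e v t) q)) , (v , t , trans (≡-sym (e v t)) p) ,
    (λ w → trans (≡-sym (combo-cong (column G) e w)) (zero-sum w))
  witness? : ∀ U → Dec (U ⊆ T × NonEmpty U × IsZeroVec (colSum G U))
  witness? U = (U ⊆? T) ×-dec ∃-ground? (λ v t → U v t ≡ true) (λ v t → U v t ≟ᵇ true)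
                        ×-dec all? (λ w → colSum G U w ≟ᵇ false)

largest-below : ∀ N (P : ℕ → Set) → (∀ m → Dec (P m)) → P 0 →
  ∃ λ k → P k × (∀ m → P m → m ≤ N → m ≤ k)
largest-below zero P P? p₀ = 0 , p₀ , (λ m _ m≤0 → m≤0)
largest-below (suc N) P P? p₀ with P? (suc N)
... | yes p = suc N , p , (λ m _ m≤N → m≤N)
... | no ¬p with largest-below N P P? p₀
...   | k , pk , maximal = k , pk , below
  where
  below : ∀ m → P m → m ≤ suc N → m ≤ k
  below m pm m≤1+N with m≤n⇒m<n∨m≡n m≤1+N
  ... | inj₁ m<1+N = maximal m pm (ℕ.≤-pred m<1+N)
  ... | inj₂ refl = ⊥-elim (¬p pm)

rank-exists : ∀ {n} (G : Graph n) (S : ESet n) → ∃ (HasRank G S)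
rank-exists {n} G S with largest-below (card (full {n})) IndependentOfSize size? empty-independent
  where
  IndependentOfSize : ℕ → Set
  IndependentOfSize k = ∃ λ T → T ⊆ S × Independent G T × card T ≡ k
  size? : ∀ k → Dec (IndependentOfSize k)
  size? k = ESet-searchable n _ respects
              (λ T → (T ⊆? S) ×-dec ¬? (dependent? G T) ×-dec (card T ℕ.≟ k))
    where
    respects : ∀ T T′ → (∀ v t → T v t ≡ T′ v t) →
      T ⊆ S × Independent G T × card T ≡ k → T′ ⊆ S × Independent G T′ × card T′ ≡ k
    respects T T′ e (T⊆S , ind , |T|≡k) =
      (λ v t q → T⊆S v t (trans (e v t) q)) ,
      (λ { (U , U⊆T′ , U≠∅ , zero-sum) → ind (U , (λ v t q → trans (e v t) (U⊆T′ v t q)) , U≠∅ , zero-sum) }) ,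
      trans (≡-sym (card-cong e)) |T|≡k
  empty-independent : IndependentOfSize 0
  empty-independent = (λ _ _ → false) , (λ v t ()) ,
    (λ { (U , U⊆∅ , (v , t , p) , _) → false≢true (U⊆∅ v t p) }) , card-empty {n} (λ _ _ → refl)
... | k , independent , maximal =
  k , independent , (λ T T⊆S ind → maximal (card T) (T , T⊆S , ind , refl) (card-mono {n} {T} (λ _ _ _ → refl)))

φ χ ψ : Fin 3
φ = zero
χ = suc zero
ψ = suc (suc zero)

-- Column φ(v) of (I A A+I) is e_v, χ(v) is A e_v and ψ(v) is A e_v + e_v,
-- so the column sum of U is  idCoeff U + A · adjCoeff U.
idCoeff adjCoeff : ∀ {n} → ESet n → GF2Vec n
idCoeff U v = U v φ xor U v ψ
adjCoeff U v = U v χ xor U v ψ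

colSum-decomposition : ∀ {n} (G : Graph n) (U : ESet n) w →
  colSum G U w ≡ idCoeff U w xor xorFin n (λ u → adjCoeff U u ∧ adj G w u)
colSum-decomposition {n} G U w = begin
  colSum G U w
    ≡⟨ xorFin-cong n (λ u → per-vertex (U u φ) (U u χ) (U u ψ) (δ w u) (adj G w u)) ⟩
  xorFin n (λ u → (idCoeff U u ∧ δ w u) xor (adjCoeff U u ∧ adj G w u))
    ≡⟨ xorFin-xor n _ _ ⟩
  xorFin n (λ u → idCoeff U u ∧ δ w u) xor A·adjCoeff
    ≡⟨ cong (_xor A·adjCoeff) (trans (xorFin-cong n (λ u → ∧-comm (idCoeff U u) (δ w u)))
                                      (xorFin-δ′ n w (idCoeff U))) ⟩
  idCoeff U w xor A·adjCoeff ∎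
  where
  open ≡-Reasoning
  A·adjCoeff : Bool
  A·adjCoeff = xorFin n (λ u → adjCoeff U u ∧ adj G w u)
  per-vertex : ∀ u₀ u₁ u₂ d a →
    (u₀ ∧ d) xor ((u₁ ∧ a) xor ((u₂ ∧ (a xor d)) xor false)) ≡ ((u₀ xor u₂) ∧ d) xor ((u₁ xor u₂) ∧ a)
  per-vertex = by-table₅ tt

φ-elements : ∀ {n} → ESet n
φ-elements v zero = true
φ-elements v (suc _) = false

card-φ-elements : ∀ {n} → card (φ-elements {n}) ≡ n
card-φ-elements {zero} = refl
card-φ-elements {suc n} = cong suc (card-φ-elements {n})

φ-elements-independent : ∀ {n} (G : Graph n) → Independent G φ-elements
φ-elements-independent {n} G (U , U⊆φ , (v , t , Uvt) , zero-sum) =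
  false≢true (trans (≡-sym (zero-sum v)) sum-at-v)
  where
  no-χ : ∀ u → U u χ ≡ false
  no-χ u = ≢true⇒false (λ p → false≢true (U⊆φ u χ p))
  no-ψ : ∀ u → U u ψ ≡ false
  no-ψ u = ≢true⇒false (λ p → false≢true (U⊆φ u ψ p))
  φ-at-v : ∀ t → U v t ≡ true → U v φ ≡ true
  φ-at-v zero p = p
  φ-at-v (suc zero) p = ⊥-elim (false≢true (trans (≡-sym (no-χ v)) p))
  φ-at-v (suc (suc zero)) p = ⊥-elim (false≢true (trans (≡-sym (no-ψ v)) p))
  sum-at-v : colSum G U v ≡ true
  sum-at-v = trans (colSum-decomposition G U v)
    (cong₂ _xor_ (cong₂ _xor_ (φ-at-v t Uvt) (no-ψ v))
                 (xorFin-false n (λ u → cong (_∧ adj G v u) (cong₂ _xor_ (no-χ u) (no-ψ u)))))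

rank-M-≥ : ∀ {n} (G : Graph n) {r} → HasRank G full r → n ≤ r
rank-M-≥ G (_ , maximal) =
  subst (_≤ _) card-φ-elements (maximal φ-elements (λ _ _ _ → refl) (φ-elements-independent G))

rank-≤-represented : ∀ {n} (G : Graph n) {S : ESet n} {a J h sel} →
  HasRank G S a → Represents J h S (column G) sel → a ≤ card J
rank-≤-represented G {J = J} {h} {sel} ((T , T⊆S , T-independent , |T|≡a) , _) rep =
  subst (_≤ card J) |T|≡a
    (steinitz (card J) J h refl T (column G) sel
      (λ U U⊆T U≠∅ zero-sum → T-independent (U , U⊆T , U≠∅ , zero-sum)) (represents-⊆ {h = h} T⊆S rep))

AtMostOncePerTriple : ∀ {n} → ESet n → Set
AtMostOncePerTriple D = ∀ v s s′ → D v s ≡ true → D v s′ ≡ true → s ≡ s′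

-- A transverse circuit contains such a set: any of its dependent subsets.
transverse-zero-sum-subset : ∀ {n} (G : Graph n) {C : ESet n} → TransverseCircuit G C →
  ∃ λ D → D ⊆ C × NonEmpty D × IsZeroVec (colSum G D) × AtMostOncePerTriple D
transverse-zero-sum-subset G ((( D , D⊆C , D≠∅ , zero-sum) , _) , T , T-transversal , C⊆T) =
  D , D⊆C , D≠∅ , zero-sum , at-most-once
  where
  in-T : ∀ {v s} → D v s ≡ true → s ≡ proj₁ (T-transversal v)
  in-T {v} {s} p = proj₂ (proj₂ (T-transversal v)) s (C⊆T v s (D⊆C v s p))
  at-most-once : AtMostOncePerTriple D
  at-most-once v s s′ p p′ = trans (in-T p) (≡-sym (in-T p′))

-- Such a set has a nonzero adjacency coefficient: otherwise its column sum
-- would be its identity part, nonzero at any vertex it meets.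
adjCoeff-nonzero : ∀ {n} (G : Graph n) {D : ESet n} → AtMostOncePerTriple D → NonEmpty D →
  IsZeroVec (colSum G D) → ∃ λ y → adjCoeff D y ≡ true
adjCoeff-nonzero {n} G {D} at-most-once (v , t , Dvt) zero-sum with any? (λ u → adjCoeff D u ≟ᵇ true)
... | yes nonzero = nonzero
... | no ¬nonzero = ⊥-elim (impossible t Dvt)
  where
  adj-zero : ∀ u → adjCoeff D u ≡ false
  adj-zero u = ≢true⇒false (λ p → ¬nonzero (u , p))
  id-zero : ∀ w → idCoeff D w ≡ false
  id-zero w = begin
    idCoeff D w                                                   ≡⟨ ≡-sym (xor-identityʳ _) ⟩
    idCoeff D w xor false                                         ≡⟨ cong (idCoeff D w xor_) (≡-sym
                                                                       (xorFin-false n (λ u → cong (_∧ adj G w u) (adj-zero u)))) ⟩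
    idCoeff D w xor xorFin n (λ u → adjCoeff D u ∧ adj G w u)    ≡⟨ ≡-sym (colSum-decomposition G D w) ⟩
    colSum G D w                                                  ≡⟨ zero-sum w ⟩
    false                                                         ∎
    where open ≡-Reasoning
  only : ∀ s s′ → s ≢ s′ → D v s ≡ true → D v s′ ≡ false
  only s s′ s≢s′ p = ≢true⇒false (λ p′ → s≢s′ (at-most-once v s s′ p p′))
  impossible : ∀ t → D v t ≡ true → ⊥
  impossible zero p = false≢true (trans (≡-sym (id-zero v)) (cong₂ _xor_ p (only φ ψ (λ ()) p)))
  impossible (suc zero) p = false≢true (trans (≡-sym (adj-zero v)) (cong₂ _xor_ p (only χ ψ (λ ()) p)))
  impossible (suc (suc zero)) p = false≢true (trans (≡-sym (id-zero v)) (cong₂ _xor_ (only ψ φ (λ ()) p) p))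

-- The separating set S and the bounds on r(S) and r(W - S).

-- Fix D with zero column sum and a vertex y with β(y) = 1, where α and β
-- are the identity and adjacency coefficients of D. Then α = A β.
module Separation {n} (G : Graph n) (D : ESet n) (zero-sum : IsZeroVec (colSum G D))
                  (y : Fin n) (β-y : adjCoeff D y ≡ true) where

  α β : GF2Vec n
  α = idCoeff D
  β = adjCoeff D

  α≡Aβ : ∀ w → α w ≡ xorFin n (λ u → β u ∧ adj G w u)
  α≡Aβ w = xor-solve (α w) _ false (trans (≡-sym (colSum-decomposition G D w)) (zero-sum w))

  met : Fin n → Bool
  met v = D v φ ∨ D v χ ∨ D v ψ

  S : ESet n
  S v t = met v

  met-of-α : ∀ d₀ d₁ d₂ → d₀ xor d₂ ≡ true → (d₀ ∨ d₁ ∨ d₂) ≡ true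
  met-of-α true d₁ d₂ _ = refl
  met-of-α false true d₂ _ = refl
  met-of-α false false true _ = refl

  met-of-β : ∀ d₀ d₁ d₂ → d₁ xor d₂ ≡ true → (d₀ ∨ d₁ ∨ d₂) ≡ true
  met-of-β true d₁ d₂ _ = refl
  met-of-β false true d₂ _ = refl
  met-of-β false false true _ = refl

  -- S is spanned by φ(v) for v met, and χ(v) for v met other than y.
  spanS : ESet n
  spanS v zero = met v
  spanS v (suc zero) = met v ∧ not (δ v y)
  spanS v (suc (suc zero)) = false

  -- A e_y = α + Σ_{u ≠ y} β(u) A e_u, read off from α = A β and β(y) = 1.
  χ-y-repr : ESet n
  χ-y-repr u zero = α u
  χ-y-repr u (suc zero) = β u ∧ not (δ u y)
  χ-y-repr u (suc (suc zero)) = false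

  χ-y-repr-⊆ : χ-y-repr ⊆ spanS
  χ-y-repr-⊆ u zero p = met-of-α (D u φ) (D u χ) (D u ψ) p
  χ-y-repr-⊆ u (suc zero) p with ∧-not-true (β u) (δ u y) p
  ... | β-u , u≢y rewrite u≢y = trans (∧-identityʳ _) (met-of-β (D u φ) (D u χ) (D u ψ) β-u)
  χ-y-repr-⊆ u (suc (suc zero)) ()

  χ-y-equation : ∀ w → adj G w y ≡ combo (column G) χ-y-repr w
  χ-y-equation w = begin
    adj G w y                ≡⟨ xor-solve (adj G w y) rest (α w) split-α ⟩
    α w xor rest             ≡⟨ cong₂ _xor_ (≡-sym (xor-identityʳ (α w)))
                                            (xorFin-cong n (λ u → regroup (β u) (not (δ u y)) (adj G w u))) ⟩
    idCoeff χ-y-repr w xor xorFin n (λ u → adjCoeff χ-y-repr u ∧ adj G w u)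
                             ≡⟨ ≡-sym (colSum-decomposition G χ-y-repr w) ⟩
    combo (column G) χ-y-repr w ∎
    where
    open ≡-Reasoning
    rest : Bool
    rest = xorFin n (λ u → not (δ u y) ∧ (β u ∧ adj G w u))
    split-α : adj G w y xor rest ≡ α w
    split-α = begin
      adj G w y xor rest           ≡⟨ cong (λ z → (z ∧ adj G w y) xor rest) (≡-sym β-y) ⟩
      (β y ∧ adj G w y) xor rest   ≡⟨ ≡-sym (xorFin-split n y (λ u → β u ∧ adj G w u)) ⟩
      xorFin n (λ u → β u ∧ adj G w u) ≡⟨ ≡-sym (α≡Aβ w) ⟩
      α w                          ∎
    regroup : ∀ b e a → e ∧ (b ∧ a) ≡ ((b ∧ e) xor false) ∧ a
    regroup = by-table₃ tt

  χ-repr : Fin n → Bool → ESet n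
  χ-repr v true = χ-y-repr
  χ-repr v false = single v χ

  reprS : Fin n → Fin 3 → ESet n
  reprS v zero = single v φ
  reprS v (suc zero) = χ-repr v (δ v y)
  reprS v (suc (suc zero)) u s = single v φ u s xor χ-repr v (δ v y) u s

  χ-represented : ∀ v → met v ≡ true → Writes spanS (column G) (column G) reprS v χ
  χ-represented v met-v with δ v y in v≟y
  ... | false = single-⊆ (trans (cong (λ z → met v ∧ not z) v≟y) (trans (∧-identityʳ (met v)) met-v)) ,
                (λ w → ≡-sym (combo-single (column G) v χ w))
  ... | true with δ-true v≟y
  ...   | refl = χ-y-repr-⊆ , χ-y-equation

  S-represented : Represents spanS (column G) S (column G) reprS
  S-represented v zero met-v = single-⊆ met-v , (λ w → ≡-sym (combo-single (column G) v φ w))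
  S-represented v (suc zero) met-v = χ-represented v met-v
  S-represented v (suc (suc zero)) met-v = inside , equation
    where
    φ-rep : Writes spanS (column G) (column G) reprS v φ
    φ-rep = S-represented v φ met-v
    χ-rep : Writes spanS (column G) (column G) reprS v χ
    χ-rep = χ-represented v met-v
    inside : reprS v ψ ⊆ spanS
    inside u s p with xor-∧-true (reprS v φ u s) true (reprS v χ u s) p
    ... | inj₁ q = proj₁ φ-rep u s q
    ... | inj₂ q = proj₁ χ-rep u s q
    equation : ∀ w → column G v ψ w ≡ combo (column G) (reprS v ψ) w
    equation w = begin
      adj G w v xor δ w v            ≡⟨ xor-comm (adj G w v) (δ w v) ⟩
      δ w v xor adj G w v            ≡⟨ cong₂ _xor_ (proj₂ φ-rep w) (proj₂ χ-rep w) ⟩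
      combo (column G) (reprS v φ) w xor combo (column G) (reprS v χ) w
                                     ≡⟨ ≡-sym (combo-lin (column G) (reprS v φ) (reprS v χ) true w) ⟩
      combo (column G) (reprS v ψ) w ∎
      where open ≡-Reasoning

  -- |spanS| + 1 = 2 |met| ≤ 2 |D|.
  spanS-size : suc (card spanS) ≤ card D + card D
  spanS-size = begin
    suc (card spanS)                              ≡⟨ +-comm 1 (card spanS) ⟩
    card spanS + 1                                ≡⟨ cong (card spanS +_) (≡-sym (sumFin-δ n y)) ⟩
    card spanS + sumFin n (λ v → b2n (δ v y))     ≡⟨ ≡-sym (sumFin-+ n _ _) ⟩
    sumFin n (λ v → row spanS v + b2n (δ v y))    ≤⟨ sumFin-mono n per-vertex ⟩
    sumFin n (λ v → row D v + row D v)            ≡⟨ sumFin-+ n _ _ ⟩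
    card D + card D                               ∎
    where
    open ℕ.≤-Reasoning
    row : ESet n → Fin n → ℕ
    row U v = sumFin 3 (λ t → b2n (U v t))
    met-≤ : ∀ d₀ d₁ d₂ → b2n (d₀ ∨ d₁ ∨ d₂) ≤ b2n d₀ + (b2n d₁ + (b2n d₂ + 0))
    met-≤ true d₁ d₂ = s≤s z≤n
    met-≤ false true d₂ = s≤s z≤n
    met-≤ false false d₂ = ≤-reflexive (≡-sym (+-identityʳ (b2n d₂)))
    two-rows : ∀ x e → (e ≡ true → x ≡ true) → b2n x + (b2n (x ∧ not e) + 0) + b2n e ≡ b2n x + b2n x
    two-rows true true _ = refl
    two-rows true false _ = refl
    two-rows false false _ = refl
    two-rows false true e⇒x = ⊥-elim (false≢true (e⇒x refl))
    y-met : met y ≡ true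
    y-met = met-of-β (D y φ) (D y χ) (D y ψ) β-y
    per-vertex : ∀ v → row spanS v + b2n (δ v y) ≤ row D v + row D v
    per-vertex v = ≤-trans (≤-reflexive (two-rows (met v) (δ v y) (λ e → subst (λ u → met u ≡ true) (≡-sym (δ-true e)) y-met)))
                           (+-mono-≤ (met-≤ (D v φ) (D v χ) (D v ψ)) (met-≤ (D v φ) (D v χ) (D v ψ)))

  rank-S : ∀ {a} → HasRank G S a → suc a ≤ card D + card D
  rank-S r-S = ≤-trans (s≤s (rank-≤-represented G {h = column G} r-S S-represented)) spanS-size

  β·_ : GF2Vec n → Bool
  β· x = xorFin n (λ u → β u ∧ x u)

  -- Columns of unmet vertices are orthogonal to β: β · e_v = β(v) = 0 and
  -- β · A e_v = (A β)(v) = α(v) = 0, using the symmetry of A.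
  unmet-orthogonal : ∀ v t → met v ≡ false → β· column G v t ≡ false
  unmet-orthogonal v t unmet = orthogonal t
    where
    untouched : ∀ d₀ d₁ d₂ → (d₀ ∨ d₁ ∨ d₂) ≡ false → d₀ ≡ false × d₁ ≡ false × d₂ ≡ false
    untouched false false false _ = refl , refl , refl
    D-v : D v φ ≡ false × D v χ ≡ false × D v ψ ≡ false
    D-v = untouched (D v φ) (D v χ) (D v ψ) unmet
    β·e : β· (λ u → δ u v) ≡ false
    β·e = trans (xorFin-cong n (λ u → ∧-comm (β u) (δ u v)))
                (trans (xorFin-δ n v β) (cong₂ _xor_ (proj₁ (proj₂ D-v)) (proj₂ (proj₂ D-v))))
    β·Ae : β· (λ u → adj G u v) ≡ false
    β·Ae = trans (xorFin-cong n (λ u → cong (β u ∧_) (Graph.sym G u v)))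
                 (trans (≡-sym (α≡Aβ v)) (cong₂ _xor_ (proj₁ D-v) (proj₂ (proj₂ D-v))))
    orthogonal : ∀ t → β· column G v t ≡ false
    orthogonal zero = β·e
    orthogonal (suc zero) = β·Ae
    orthogonal (suc (suc zero)) =
      trans (xorFin-cong n (λ u → ∧-distribˡ-xor (β u) (adj G u v) (δ u v)))
            (trans (xorFin-xor n _ _) (cong₂ _xor_ β·Ae β·e))

  -- The orthogonal complement of β is spanned by the n - 1 vectors
  -- e_v + β(v) e_y, v ≠ y, indexed by the φ-elements other than φ(y).
  spanᶜ : ESet n
  spanᶜ v zero = not (δ v y)
  spanᶜ v (suc _) = false

  perp : Family n n
  perp v t w = δ w v xor (β v ∧ δ w y)

  -- x = Σ_{v ≠ y} x(v) (e_v + β(v) e_y) when β · x = 0.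
  reprᶜ : GF2Vec n → ESet n
  reprᶜ x v zero = not (δ v y) ∧ x v
  reprᶜ x v (suc _) = false

  orthogonal-at-y : ∀ x → β· x ≡ false → xorFin n (λ v → not (δ v y) ∧ (x v ∧ β v)) ≡ x y
  orthogonal-at-y x β⊥x = begin
    xorFin n (λ v → not (δ v y) ∧ (x v ∧ β v))
      ≡⟨ ≡-sym (xor-solve (x y ∧ β y) _ false
                  (trans (≡-sym (xorFin-split n y (λ v → x v ∧ β v)))
                         (trans (xorFin-cong n (λ v → ∧-comm (x v) (β v))) β⊥x))) ⟩
    x y ∧ β y  ≡⟨ cong (x y ∧_) β-y ⟩
    x y ∧ true ≡⟨ ∧-identityʳ (x y) ⟩
    x y        ∎
    where open ≡-Reasoning

  orthogonal-represented : ∀ x → β· x ≡ false →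
    reprᶜ x ⊆ spanᶜ × (∀ w → x w ≡ combo perp (reprᶜ x) w)
  orthogonal-represented x β⊥x = inside , equation
    where
    inside : reprᶜ x ⊆ spanᶜ
    inside v zero p = ∧-true⇒left _ _ p
    inside v (suc _) ()
    at-w : ∀ w → (not (δ w y) ∧ x w) xor (x y ∧ δ w y) ≡ x w
    at-w w with δ w y in w≟y
    ... | false = trans (cong (x w xor_) (∧-comm (x y) false)) (xor-identityʳ (x w))
    ... | true with δ-true w≟y
    ...   | refl = ∧-identityʳ (x y)
    expand : ∀ e x b d d′ → ((e ∧ x) ∧ (d xor (b ∧ d′))) xor false ≡ ((e ∧ x) ∧ d) xor ((e ∧ (x ∧ b)) ∧ d′)
    expand = by-table₅ tt
    equation : ∀ w → x w ≡ combo perp (reprᶜ x) w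
    equation w = ≡-sym (begin
      combo perp (reprᶜ x) w
        ≡⟨ xorFin-cong n (λ v → expand (not (δ v y)) (x v) (β v) (δ w v) (δ w y)) ⟩
      xorFin n (λ v → ((not (δ v y) ∧ x v) ∧ δ w v) xor ((not (δ v y) ∧ (x v ∧ β v)) ∧ δ w y))
        ≡⟨ xorFin-xor n _ _ ⟩
      xorFin n (λ v → (not (δ v y) ∧ x v) ∧ δ w v) xor xorFin n (λ v → (not (δ v y) ∧ (x v ∧ β v)) ∧ δ w y)
        ≡⟨ cong₂ _xor_ (trans (xorFin-cong n (λ v → ∧-comm (not (δ v y) ∧ x v) (δ w v)))
                              (xorFin-δ′ n w (λ v → not (δ v y) ∧ x v)))
                       (trans (xorFin-∧ʳ n _ (δ w y)) (cong (_∧ δ w y) (orthogonal-at-y x β⊥x))) ⟩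
      (not (δ w y) ∧ x w) xor (x y ∧ δ w y)
        ≡⟨ at-w w ⟩
      x w ∎)
      where open ≡-Reasoning

  complement-represented : Represents spanᶜ perp (compl S) (column G) (λ v t → reprᶜ (column G v t))
  complement-represented v t unmet =
    orthogonal-represented (column G v t) (unmet-orthogonal v t (not-true unmet))
    where
    not-true : ∀ {b} → not b ≡ true → b ≡ false
    not-true {false} _ = refl

  spanᶜ-size : suc (card spanᶜ) ≡ n
  spanᶜ-size = begin
    suc (card spanᶜ)                        ≡⟨ cong suc (card-cong same) ⟩
    suc (card (remove φ-elements y φ))      ≡⟨ ≡-sym (card-remove φ-elements y φ refl) ⟩
    card (φ-elements {n})                   ≡⟨ card-φ-elements ⟩
    n                                       ∎
    where
    open ≡-Reasoning
    same : ∀ v t → spanᶜ v t ≡ remove φ-elements y φ v t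
    same v zero = cong not (≡-sym (∧-identityʳ (δ v y)))
    same v (suc _) = refl

  rank-complement : ∀ {b} → HasRank G (compl S) b → suc b ≤ n
  rank-complement r-Sᶜ = subst (_ ≤_) spanᶜ-size (s≤s (rank-≤-represented G {h = perp} r-Sᶜ complement-represented))

separation-order : ∀ a b r → suc a ≤ r → suc b ≤ r →
  let k = suc (a + b) ∸ r in a + b < k + r × k ≤ a × k ≤ b
separation-order a b r a<r b<r =
  subst (suc (a + b) ≤_) (+-comm r _) (m≤n+m∸n (suc (a + b)) r) ,
  m≤n+o⇒m∸n≤o (suc (a + b)) r (subst (_≤ r + a) (cong suc (+-comm b a)) (+-monoˡ-≤ a b<r)) ,
  m≤n+o⇒m∸n≤o (suc (a + b)) r (+-monoˡ-≤ b a<r)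

-- Proposition 28. D ⊆ C is a zero-sum subset of a smallest transverse
-- circuit; S is the union of the triples it meets. Then r(S) < 2|D| ≤ 2q ≤ n
-- and r(W - S) < n ≤ r(M), so S is a vertical k-separation for some
-- k ≤ r(S) < 2q.
proposition28 : ∀ (n : ℕ) (G : Graph n) (q κ : ℕ) →
    IsMinTransverseCircuitSize G q → IsKappa G κ →
    2 * q < suc n → suc κ ≤ 2 * q
proposition28 n G q κ ((C , C-transverse , |C|≡q) , _) (r , rank-M , _ , _ , κ-minimal) 2q<1+n
  with transverse-zero-sum-subset G C-transverse
... | D , D⊆C , D≠∅ , zero-sum , at-most-once
  with adjCoeff-nonzero G at-most-once D≠∅ zero-sum
... | y , β-y = ≤-trans (s≤s (≤-trans κ≤k (proj₁ (proj₂ order)))) a<2q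
  where
  open Separation G D zero-sum y β-y
  S-rank : ∃ (HasRank G S)
  S-rank = rank-exists G S
  Sᶜ-rank : ∃ (HasRank G (compl S))
  Sᶜ-rank = rank-exists G (compl S)
  a b k : ℕ
  a = proj₁ S-rank
  b = proj₁ Sᶜ-rank
  k = suc (a + b) ∸ r
  n≤r : n ≤ r
  n≤r = rank-M-≥ G rank-M
  |D|≤q : card D ≤ q
  |D|≤q = subst (card D ≤_) |C|≡q (card-mono D⊆C)
  a<2q : suc a ≤ 2 * q
  a<2q = ≤-trans (rank-S (proj₂ S-rank)) (+-mono-≤ |D|≤q (subst (card D ≤_) (≡-sym (+-identityʳ q)) |D|≤q))
  order : a + b < k + r × k ≤ a × k ≤ b
  order = separation-order a b r (≤-trans a<2q (≤-trans (ℕ.≤-pred 2q<1+n) n≤r))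
                                 (≤-trans (rank-complement (proj₂ Sᶜ-rank)) n≤r)
  κ≤k : κ ≤ k
  κ≤k = κ-minimal k (S , a , b , r , proj₂ S-rank , proj₂ Sᶜ-rank , rank-M , order)
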